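{- Let $B$ be a bipartite chain graph with maximum degree $\Delta$ and let $v$ be a vertex of $B$. Then $|N^2(v)|\le\Delta$.
   Context: $N(u)$ is the neighbourhood of $u$ in $B$ and $N^2(v)$ is the set of vertices at distance exactly $2$ from $v$ in $B$. Two vertices $a,b$ are comparable if $N(a)\subseteq N(b)$ or $N(b)\subseteq N(a)$. A bipartite graph with bipartition $(P,Q)$ is a bipartite chain graph if any two vertices of $P$ are comparable and any two vertices of $Q$ are comparable. -}

module Defs where

open import Data.Nat using (ℕ; _⊔_)
open import Data.Bool using (Bool; true; false; _∧_; not)
open import Data.Fin using (Fin; _≟_)
open import Data.Fin.Properties using (any?)
open import Relation.Nullary using (_×-dec_; ¬?)
open import Data.List using (List; filter; length; foldr; map; allFin)
open import Data.Product using (_×_; Σ; ∃; ∃-syntax; _,_)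
open import Data.Sum using (_⊎_)
open import Relation.Nullary using (¬_; Dec; yes; no)
open import Relation.Unary using (Pred; _⊆_)
open import Relation.Binary using (Rel; Decidable)
open import Relation.Binary.PropositionalEquality using (_≡_; _≢_)

record Graph (n : ℕ) : Set₁ where
  field
    Adj      : Rel (Fin n) _
    adj?     : Decidable Adj
    sym      : ∀ {u v} → Adj u v → Adj v u
    irrefl   : ∀ {u} → ¬ Adj u u

module _ {n : ℕ} (G : Graph n) where
  open Graph G

  N : Fin n → Pred (Fin n) _
  N u w = Adj u w

  nbrs : Fin n → List (Fin n)
  nbrs u = filter (adj? u) (allFin n)

  degree : Fin n → ℕ
  degree u = length (nbrs u)

  -- maximum degree Δ(G)  (0 for the empty graph)
  maxDegree : ℕ
  maxDegree = foldr _⊔_ 0 (map degree (allFin n))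

  Dist2 : Fin n → Pred (Fin n) _
  Dist2 v w = w ≢ v × ¬ Adj v w × ∃[ u ] (Adj v u × Adj u w)

  dist2? : ∀ v w → Dec (Dist2 v w)
  dist2? v w = ¬? (w ≟ v) ×-dec (¬? (adj? v w) ×-dec any? (λ u → adj? v u ×-dec adj? u w))

  N2 : Fin n → List (Fin n)
  N2 v = filter (dist2? v) (allFin n)

  Comparable : Fin n → Fin n → Set
  Comparable a b = (N a ⊆ N b) ⊎ (N b ⊆ N a)

  -- (P,Q) bipartition given by side : Fin n → Bool (P = true side, Q = false side):
  -- every edge joins the two sides.
  IsBipartition : (Fin n → Bool) → Set
  IsBipartition side = ∀ {u w} → Adj u w → side u ≢ side w

  IsBipartiteChain : Set
  IsBipartiteChain = Σ (Fin n → Bool) λ side →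
    IsBipartition side × (∀ a b → side a ≡ side b → Comparable a b)

-- Every neighbour of v lies on the side opposite to v, so the neighbourhoods
-- of the neighbours of v form a chain under inclusion; let c be a neighbour of
-- v whose neighbourhood is the largest. A vertex at distance two from v is
-- adjacent to some neighbour of v, hence to c, so N²(v) ⊆ N(c) and
-- |N²(v)| ≤ deg c ≤ Δ.
module Submission where

open import Defs
open import Data.Bool.Properties using (¬-not)
open import Data.Empty using (⊥-elim)
open import Data.Fin using (Fin)
open import Data.Fin.Properties using (any?)
open import Data.List using (List; []; _∷_; length; filter; foldr; map; allFin)
open import Data.List.Membership.Propositional using (_∈_)
open import Data.List.Membership.Propositional.Properties using (∈-allFin; ∈-map⁺)
open import Data.List.Relation.Unary.Any using (here; there)
open import Data.List.Relation.Binary.Sublist.Propositional.Properties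
  using (filter⁺; length-mono-≤)
open import Data.List.Relation.Binary.Sublist.Propositional using (⊆-refl)
open import Data.Nat using (ℕ; _≤_; _⊔_)
open import Data.Nat.Properties using (≤-trans; m≤m⊔n; m≤n⊔m)
open import Data.Product using (∃-syntax; _×_; _,_)
open import Data.Sum using (_⊎_; inj₁; inj₂)
open import Level using (Level)
open import Relation.Binary using (Rel; Transitive)
open import Relation.Binary.PropositionalEquality using (_≡_; refl; sym; trans)
open import Relation.Nullary using (yes; no)
open import Relation.Unary using (Pred; _⊆_)
import Relation.Unary as U

private
  variable
    a p q r : Level
    A : Set a

length-filter-mono : {P : Pred A p} {Q : Pred A q} (P? : U.Decidable P) (Q? : U.Decidable Q) →
  P ⊆ Q → ∀ xs → length (filter P? xs) ≤ length (filter Q? xs)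
length-filter-mono P? Q? P⊆Q xs = length-mono-≤ (filter⁺ P? Q? (λ { refl → P⊆Q }) (⊆-refl {x = xs}))

≤-foldr-⊔ : ∀ {x xs} → x ∈ xs → x ≤ foldr _⊔_ 0 xs
≤-foldr-⊔ {x} (here refl) = m≤m⊔n x _
≤-foldr-⊔ {xs = y ∷ _} (there x∈xs) = ≤-trans (≤-foldr-⊔ x∈xs) (m≤n⊔m y _)

module _ {P : Pred A p} (P? : U.Decidable P) {_≼_ : Rel A r} (≼-trans : Transitive _≼_)
         (≼-total : ∀ {x y} → P x → P y → x ≼ y ⊎ y ≼ x) where

  ∃-greatest : ∀ {x₀} → P x₀ → (xs : List A) → ∃[ c ] P c × (∀ {x} → x ∈ xs → P x → x ≼ c)
  ∃-greatest Px₀ [] = _ , Px₀ , λ ()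
  ∃-greatest Px₀ (y ∷ ys) with ∃-greatest Px₀ ys | P? y
  ... | c , Pc , ys≼c | no ¬Py = c , Pc , λ { (here refl) Py → ⊥-elim (¬Py Py)
                                            ; (there x∈ys) → ys≼c x∈ys }
  ... | c , Pc , ys≼c | yes Py with ≼-total Py Pc
  ...   | inj₁ y≼c = c , Pc , λ { (here refl) _ → y≼c ; (there x∈ys) → ys≼c x∈ys }
  ...   | inj₂ c≼y = y , Py , λ { (here refl) _ → y≼y ; (there x∈ys) Px → ≼-trans (ys≼c x∈ys Px) c≼y }
    where
    y≼y : y ≼ y
    y≼y with ≼-total Py Py
    ... | inj₁ y≼y = y≼y
    ... | inj₂ y≼y = y≼y

module _ {n : ℕ} (B : Graph n) where
  open Graph B using (Adj; adj?)

  degree≤maxDegree : ∀ u → degree B u ≤ maxDegree B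
  degree≤maxDegree u = ≤-foldr-⊔ (∈-map⁺ (degree B) (∈-allFin u))

  neighbours-sameSide : ∀ {side} → IsBipartition B side →
    ∀ {v x y} → Adj v x → Adj v y → side x ≡ side y
  neighbours-sameSide bip vx vy =
    trans (¬-not (λ e → bip vx (sym e))) (sym (¬-not (λ e → bip vy (sym e))))

  ∃-largestNeighbourhood : IsBipartiteChain B → ∀ {v u₀} → Adj v u₀ →
    ∃[ c ] Adj v c × (∀ {u} → Adj v u → N B u ⊆ N B c)
  ∃-largestNeighbourhood (side , bip , comparable) {v} vu₀
    with ∃-greatest (adj? v) {λ x y → N B x ⊆ N B y} (λ x⊆y y⊆z w → y⊆z (x⊆y w))
           (λ vx vy → comparable _ _ (neighbours-sameSide bip vx vy)) vu₀ (allFin n)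
  ... | c , vc , greatest = c , vc , greatest (∈-allFin _)

  ∃-Dist2⊆N : IsBipartiteChain B → ∀ v → ∃[ c ] Dist2 B v ⊆ N B c
  ∃-Dist2⊆N chain v with any? (adj? v)
  ... | no isolated = v , λ (_ , _ , u , vu , _) → ⊥-elim (isolated (u , vu))
  ... | yes (_ , vu₀) with ∃-largestNeighbourhood chain vu₀
  ...   | c , _ , largest = c , λ (_ , _ , u , vu , uw) → largest vu uw

lemma13 : {n : ℕ} (B : Graph n) → IsBipartiteChain B → (v : Fin n) →
    length (N2 B v) ≤ maxDegree B
lemma13 {n} B chain v with ∃-Dist2⊆N B chain v
... | c , Dist2⊆Nc =
  ≤-trans (length-filter-mono (dist2? B v) (Graph.adj? B c) Dist2⊆Nc (allFin n))
          (degree≤maxDegree B c)
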